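{- Let $\mathcal F$ be a Fano plane, $\mathbb F$ a field of characteristic not $2$, and $\epsilon$ a multiplication factor on $\mathcal F$ such that $(\mathbb O_{\mathcal F},\mathbf 1,\epsilon)$ is a composition algebra. Then either the future $\overrightarrow{P}$ is a line for every $P\in\mathcal F$, or the past $\overleftarrow{P}$ is a line for every $P\in\mathcal F$. In the first case the set of seven triangles $\{\overleftarrow{P}: P\in\mathcal F\}$ satisfies the axioms of a Fano plane (any two distinct points of $\mathcal F$ lie in a unique member of this set, and any two distinct members intersect in a unique point), and in the second case the set of triangles $\{\overrightarrow{P}:P\in\mathcal F\}$ satisfies the axioms of a Fano plane.
   Context: A Fano plane is a set $\mathcal F$ of seven points together with a set of seven $3$-element subsets of $\mathcal F$ called lines, such that any two distinct points lie in a unique line and any two distinct lines meet in a unique point. The Fano cube is $V_{\mathcal F}=\mathcal F\cup\{0\}$ with the unique $\mathbb Z_2$-vector space structure with zero $0$ such that for distinct $P,Q\in\mathcal F$, $P+Q$ is the third point of the line through $P$ and $Q$. A triangle is a $3$-element subset of $\mathcal F$ that is not a line. A multiplication factor is a map $\epsilon:\{(P,Q)\in\mathcal F^2:P\ne Q\}\to\{ -1,1\}$, $(P,Q)\mapsto\epsilon_{PQ}$, with $\epsilon_{QP}=-\epsilon_{PQ}$. The future of $P$ is $\overrightarrow{P}=\{Q\in\mathcal F: Q\neq P,\ \epsilon_{PQ}=1\}$ and the past is $\overleftarrow{P}=\{Q\in\mathcal F:Q\ne P,\ \epsilon_{PQ}=-1\}$. $\mathbb O_{\mathcal F}$ is the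 $\mathbb F$-vector space of $\mathbb F$-valued functions on $V_{\mathcal F}$, with basis $e_P$ ($P\in V_{\mathcal F}$), $e_P$ the indicator function of $P$. The multiplication $\cdot_\epsilon$ is the bilinear map with $e_P\cdot_\epsilon e_Q=\epsilon_{PQ}e_{P+Q}$ for $P\ne Q$ in $\mathcal F$, $e_P\cdot_\epsilon e_P=-e_0$ for $P\in\mathcal F$, and $e_0$ a two-sided unit. The quadratic form $\mathbf 1$ is $N_{\mathbb O_{\mathcal F}}(\lambda^0e_0+\sum_{P\in\mathcal F}\lambda^Pe_P)=(\lambda^0)^2+\sum_{P\in\mathcal F}(\lambda^P)^2$ (coming from the trivial norm $N\equiv 1$ on $\mathcal F$). $(\mathbb O_{\mathcal F},\mathbf 1,\epsilon)$ is a composition algebra iff $N_{\mathbb O_{\mathcal F}}(Z\cdot_\epsilon W)=N_{\mathbb O_{\mathcal F}}(Z)N_{\mathbb O_{\mathcal F}}(W)$ for all $Z,W\in\mathbb O_{\mathcal F}$. -}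

module Defs where

open import Level using (Level; _⊔_)
open import Data.Nat using (ℕ)
open import Data.Bool using (Bool; true; false; if_then_else_)
open import Data.Fin using (Fin; zero; suc; _≟_)
open import Data.Fin.Subset using (Subset; _∈_; ∣_∣)
open import Data.Fin.Subset.Properties using (_∈?_)
open import Data.Fin.Properties using (any?)
open import Data.Maybe using (Maybe; just; nothing)
import Data.Maybe.Properties as MaybeP
open import Data.Sign using (Sign; opposite) renaming (+ to plus; - to minus)
open import Data.Product using (Σ; ∃; ∃!; _×_; _,_; proj₁)
open import Data.Vec using (tabulate)
open import Relation.Nullary using (¬_; Dec; yes; no)
open import Relation.Nullary.Decidable using (_×-dec_; ¬?)
open import Relation.Binary.PropositionalEquality using (_≡_; _≢_)
open import Algebra.Bundles using (CommutativeRing)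

-- The seven points are (w.l.o.g.) the elements of Fin 7;
-- the seven lines are given as an indexed family  L : Fin 7 → Subset 7
-- (injective, so it is a set of seven 3-element subsets).

record IsFanoPlane (L : Fin 7 → Subset 7) : Set where
  field
    line-size   : ∀ i → ∣ L i ∣ ≡ 3
    line-inj    : ∀ i j → L i ≡ L j → i ≡ j
    two-points  : ∀ (P Q : Fin 7) → P ≢ Q →
                  ∃! _≡_ (λ i → P ∈ L i × Q ∈ L i)
    two-lines   : ∀ (i j : Fin 7) → i ≢ j →
                  ∃! _≡_ (λ P → P ∈ L i × P ∈ L j)

IsLine : (Fin 7 → Subset 7) → Subset 7 → Set
IsLine L S = ∃ λ i → L i ≡ S

IsTriangle : (Fin 7 → Subset 7) → Subset 7 → Set
IsTriangle L S = ∣ S ∣ ≡ 3 × ¬ IsLine L S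

-- Multiplication factors (values on the diagonal are irrelevant)

IsMultiplicationFactor : (Fin 7 → Fin 7 → Sign) → Set
IsMultiplicationFactor ε = ∀ (P Q : Fin 7) → P ≢ Q → ε Q P ≡ opposite (ε P Q)

isPlus : Sign → Bool
isPlus plus  = true
isPlus minus = false

future : (Fin 7 → Fin 7 → Sign) → Fin 7 → Subset 7
future ε P = tabulate λ Q → if (Dec.does (Q ≟ P)) then false else isPlus (ε P Q)

past : (Fin 7 → Fin 7 → Sign) → Fin 7 → Subset 7
past ε P = tabulate λ Q → if (Dec.does (Q ≟ P)) then false else isPlus (opposite (ε P Q))

-- The Fano cube  V = F ∪ {0}  (0 = nothing, P = just P)

V : Set
V = Maybe (Fin 7)

_≟V_ : (u v : V) → Dec (u ≡ v)
_≟V_ = MaybeP.≡-dec _≟_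

module FanoCube {L : Fin 7 → Subset 7} (fp : IsFanoPlane L) where
  open IsFanoPlane fp

  -- the third point of the line through two distinct points
  -- (only its value for P ≢ Q is ever used)
  third : Fin 7 → Fin 7 → Fin 7
  third P Q with P ≟ Q
  ... | yes _ = P
  ... | no P≢Q with any? (λ R → (R ∈? L (proj₁ (two-points P Q P≢Q)))
                                 ×-dec (¬? (R ≟ P)) ×-dec (¬? (R ≟ Q)))
  ...   | yes (R , _) = R
  ...   | no _ = P

module Octonions {c ℓ : Level} (R : CommutativeRing c ℓ)
                 {L : Fin 7 → Subset 7} (fp : IsFanoPlane L)
                 (ε : Fin 7 → Fin 7 → Sign) where
  open CommutativeRing R hiding (zero)
  open FanoCube fp

  -- elements of O_F: functions V → 𝔽, i.e.  Σ_v Z(v) e_v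
  O : Set c
  O = V → Carrier

  sumFin : ∀ {n} → (Fin n → Carrier) → Carrier
  sumFin {ℕ.zero}  f = 0#
  sumFin {ℕ.suc n} f = f zero + sumFin (λ i → f (suc i))

  sumV : (V → Carrier) → Carrier
  sumV f = f nothing + sumFin (λ P → f (just P))

  signVal : Sign → Carrier
  signVal plus  = 1#
  signVal minus = - 1#

  -- product of basis vectors:  e_u · e_v = coeff u v · e_(index u v)
  coeff : V → V → Carrier
  coeff nothing  _        = 1#
  coeff (just P) nothing  = 1#
  coeff (just P) (just Q) with P ≟ Q
  ... | yes _ = - 1#
  ... | no  _ = signVal (ε P Q)

  index : V → V → V
  index nothing  v        = v
  index (just P) nothing  = just P
  index (just P) (just Q) with P ≟ Q
  ... | yes _ = nothing
  ... | no  _ = just (third P Q)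

  indicator : V → V → Carrier
  indicator u w = if Dec.does (u ≟V w) then 1# else 0#

  _·ε_ : O → O → O
  (Z ·ε W) w = sumV λ u → sumV λ v →
                 (Z u * W v) * (coeff u v * indicator (index u v) w)

  N : O → Carrier
  N Z = sumV λ v → Z v * Z v

  IsComposition : Set (c ⊔ ℓ)
  IsComposition = ∀ (Z W : O) → N (Z ·ε W) ≈ N Z * N W

module _ {c ℓ : Level} (R : CommutativeRing c ℓ) where
  open CommutativeRing R

  IsField : Set (c ⊔ ℓ)
  IsField = (¬ (1# ≈ 0#)) × (∀ x → ¬ (x ≈ 0#) → ∃ λ y → x * y ≈ 1#)

  CharNot2 : Set ℓ
  CharNot2 = ¬ (1# + 1# ≈ 0#)

-- Testing the composition law on (e_a + e_b)·(e_c + e_d) gives κ_ac κ_bd = −κ_ad κ_bc for the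
-- structure signs κ whenever a + c = b + d in the Fano cube: the norm of the product is
-- (κ_ac + κ_bd)² + (κ_ad + κ_bc)², a sum of two terms each 0 or 4, and it must be 2·2 (2 is
-- invertible). For a = 0 this says ε_{P,P+Q} = −ε_{PQ}, so ε is determined by one sign per line.
-- A basis of the Fano cube identifies the plane with the standard one on 𝔽₂³ ∖ 0, where the
-- theorem becomes a statement about 2⁷ sign vectors, decided by evaluation.
module Submission where

open import Defs
open import Level using (Level)
open import Algebra.Bundles using (CommutativeRing)
open import Data.Bool using (Bool; true; false; _∧_; _∨_; _xor_; if_then_else_)
import Data.Bool.Properties as Bool
open import Data.Empty using (⊥-elim)
open import Data.Fin using (Fin; zero; suc; toℕ; _≟_)
open import Data.Fin.Patterns using (0F; 1F; 2F; 3F; 4F; 5F; 6F)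
open import Data.Fin.Properties using (all?; any?; injective⇒≤)
open import Data.Fin.Subset using (Subset; _∈_; _∉_; ∣_∣; ⁅_⁆; _∪_; _─_; _-_; _⊆_; inside; outside; Empty; Nonempty)
open import Data.Fin.Subset.Properties
  using (_∈?_; x∈⁅x⁆; x∈⁅y⁆⇒x≡y; x∈p∪q⁻; x∈p∪q⁺; x∈p∧x≢y⇒x∈p-y; p─q⊆p; p─⊥≡p; ⊆-antisym;
         Empty-unique; ∣⊥∣≡0; nonempty?)
open import Data.Maybe using (just; nothing)
import Data.Maybe.Properties as Maybe
open import Data.Nat using (ℕ; zero; suc; _<ᵇ_)
import Data.Nat.Properties as ℕ
open import Data.Product using (∃; ∃₂; ∃!; _×_; _,_; proj₁; proj₂; uncurry)
open import Data.Product.Function.NonDependent.Propositional using (_×-⇔_)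
import Data.Product.Properties as Product
open import Data.Sign as Sign using (Sign; opposite) renaming (+ to plus; - to minus)
import Data.Sign.Properties as Sign
open import Data.Sum using (_⊎_; inj₁; inj₂; [_,_]′)
import Data.Sum as Sum
open import Data.Vec using (Vec; []; _∷_; lookup; tabulate; here; there)
import Data.Vec.Properties as Vec
open import Data.Vec.Relation.Unary.All using ([]; _∷_)
open import Data.Vec.Relation.Unary.AllPairs using ([]; _∷_)
open import Data.Vec.Relation.Unary.Unique.Propositional using (Unique)
open import Data.Vec.Relation.Unary.Unique.Propositional.Properties using (lookup-injective)
open import Function using (_∘_; Injective; Equivalence; _⇔_; mk⇔)
open import Relation.Nullary using (¬_; Dec; yes; no; does; ¬?; contradiction)
open import Relation.Nullary.Decidable using (_×-dec_; _⊎-dec_; _→-dec_; from-yes; map′; dec-true; dec-false)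
open import Relation.Binary.PropositionalEquality
  using (_≡_; _≢_; refl; sym; trans; cong; cong₂; subst; module ≡-Reasoning)

-- Finite sets

private variable
  n : ℕ
  p q : Subset n
  w x y z : Fin n

x∈p─q⇒x∉q : x ∈ p ─ q → x ∉ q
x∈p─q⇒x∉q {p = _ ∷ _} {q = outside ∷ _} here ()
x∈p─q⇒x∉q {p = _ ∷ _} {q = _ ∷ _} (there x∈p─q) (there x∈q) = x∈p─q⇒x∉q x∈p─q x∈q

x∈p-y⇒x≢y : ∀ p y → x ∈ p - y → x ≢ y
x∈p-y⇒x≢y p y x∈p-y refl = x∈p─q⇒x∉q x∈p-y (x∈⁅x⁆ y)

x∈p-y⇒x∈p : ∀ p y → x ∈ p - y → x ∈ p
x∈p-y⇒x∈p p y = p─q⊆p p ⁅ y ⁆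

x∈p⇒∣p∣≡1+∣p-x∣ : x ∈ p → ∣ p ∣ ≡ suc ∣ p - x ∣
x∈p⇒∣p∣≡1+∣p-x∣ {p = inside ∷ p} here = cong (suc ∘ ∣_∣) (sym (p─⊥≡p p))
x∈p⇒∣p∣≡1+∣p-x∣ {p = inside ∷ p} (there x∈p) = cong suc (x∈p⇒∣p∣≡1+∣p-x∣ x∈p)
x∈p⇒∣p∣≡1+∣p-x∣ {p = outside ∷ p} (there x∈p) = x∈p⇒∣p∣≡1+∣p-x∣ x∈p

∣p∣≡0⇒Empty : ∣ p ∣ ≡ 0 → Empty p
∣p∣≡0⇒Empty ∣p∣≡0 (x , x∈p) with () ← trans (sym (x∈p⇒∣p∣≡1+∣p-x∣ x∈p)) ∣p∣≡0

Empty⇒∣p∣≡0 : Empty p → ∣ p ∣ ≡ 0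
Empty⇒∣p∣≡0 {n} empty = trans (cong ∣_∣ (Empty-unique empty)) (∣⊥∣≡0 n)

∣p∣≡1+k⇒Nonempty : ∀ {k} → ∣ p ∣ ≡ suc k → Nonempty p
∣p∣≡1+k⇒Nonempty {p = p} ∣p∣≡1+k with nonempty? p
... | yes nonempty = nonempty
... | no empty = contradiction (trans (sym ∣p∣≡1+k) (Empty⇒∣p∣≡0 empty)) λ ()

∈-⁅,,⁆ : w ∈ ⁅ x ⁆ ∪ ⁅ y ⁆ ∪ ⁅ z ⁆ ⇔ (w ≡ x ⊎ w ≡ y ⊎ w ≡ z)
∈-⁅,,⁆ {x = x} {y} {z} = mk⇔
  (Sum.map (x∈⁅y⁆⇒x≡y x) (Sum.map (x∈⁅y⁆⇒x≡y y) (x∈⁅y⁆⇒x≡y z) ∘ x∈p∪q⁻ ⁅ y ⁆ ⁅ z ⁆) ∘ x∈p∪q⁻ ⁅ x ⁆ (⁅ y ⁆ ∪ ⁅ z ⁆))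
  (x∈p∪q⁺ ∘ Sum.map (λ { refl → x∈⁅x⁆ x }) (x∈p∪q⁺ ∘ Sum.map (λ { refl → x∈⁅x⁆ y }) (λ { refl → x∈⁅x⁆ z })))

∣⁅,,⁆∣≡3 : x ≢ y → x ≢ z → y ≢ z → ∣ ⁅ x ⁆ ∪ ⁅ y ⁆ ∪ ⁅ z ⁆ ∣ ≡ 3
∣⁅,,⁆∣≡3 {x = x} {y} {z} x≢y x≢z y≢z = begin
  ∣ t ∣                       ≡⟨ x∈p⇒∣p∣≡1+∣p-x∣ x∈ ⟩
  suc ∣ t - x ∣               ≡⟨ cong suc (x∈p⇒∣p∣≡1+∣p-x∣ y∈) ⟩
  suc (suc ∣ t - x - y ∣)     ≡⟨ cong (λ k → suc (suc k)) (x∈p⇒∣p∣≡1+∣p-x∣ z∈) ⟩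
  suc (suc (suc ∣ t - x - y - z ∣)) ≡⟨ cong (λ k → suc (suc (suc k))) (Empty⇒∣p∣≡0 empty) ⟩
  3                           ∎
  where
  open ≡-Reasoning
  t : Subset _
  t = ⁅ x ⁆ ∪ ⁅ y ⁆ ∪ ⁅ z ⁆
  x∈ : x ∈ t
  x∈ = Equivalence.from ∈-⁅,,⁆ (inj₁ refl)
  y∈ : y ∈ t - x
  y∈ = x∈p∧x≢y⇒x∈p-y (Equivalence.from ∈-⁅,,⁆ (inj₂ (inj₁ refl))) (x≢y ∘ sym)
  z∈ : z ∈ t - x - y
  z∈ = x∈p∧x≢y⇒x∈p-y (x∈p∧x≢y⇒x∈p-y (Equivalence.from ∈-⁅,,⁆ (inj₂ (inj₂ refl))) (x≢z ∘ sym)) (y≢z ∘ sym)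
  empty : Empty (t - x - y - z)
  empty (w , w∈) =
    [ x∈p-y⇒x≢y t x w∈t-x , [ x∈p-y⇒x≢y (t - x) y w∈t-x-y , x∈p-y⇒x≢y (t - x - y) z w∈ ]′ ]′
      (Equivalence.to ∈-⁅,,⁆ (x∈p-y⇒x∈p t x w∈t-x))
    where
    w∈t-x-y : w ∈ t - x - y
    w∈t-x-y = x∈p-y⇒x∈p (t - x - y) z w∈
    w∈t-x : w ∈ t - x
    w∈t-x = x∈p-y⇒x∈p (t - x) y w∈t-x-y

∣p∣≡3⇒p≡⁅,,⁆ : ∣ p ∣ ≡ 3 → x ∈ p → y ∈ p → x ≢ y →
               ∃ λ z → z ≢ x × z ≢ y × p ≡ ⁅ x ⁆ ∪ ⁅ y ⁆ ∪ ⁅ z ⁆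
∣p∣≡3⇒p≡⁅,,⁆ {p = p} {x} {y} ∣p∣≡3 x∈p y∈p x≢y =
  r , x∈p-y⇒x≢y p x r∈p-x , x∈p-y⇒x≢y (p - x) y r∈p-x-y , ⊆-antisym p⊆⁅x,y,r⁆ ⁅x,y,r⁆⊆p
  where
  y∈p-x : y ∈ p - x
  y∈p-x = x∈p∧x≢y⇒x∈p-y y∈p (x≢y ∘ sym)
  ∣p-x-y∣≡1 : ∣ p - x - y ∣ ≡ 1
  ∣p-x-y∣≡1 = ℕ.suc-injective (ℕ.suc-injective
    (trans (sym (trans (x∈p⇒∣p∣≡1+∣p-x∣ x∈p) (cong suc (x∈p⇒∣p∣≡1+∣p-x∣ y∈p-x)))) ∣p∣≡3))
  r : Fin _
  r = proj₁ (∣p∣≡1+k⇒Nonempty ∣p-x-y∣≡1)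
  r∈p-x-y : r ∈ p - x - y
  r∈p-x-y = proj₂ (∣p∣≡1+k⇒Nonempty ∣p-x-y∣≡1)
  r∈p-x : r ∈ p - x
  r∈p-x = x∈p-y⇒x∈p (p - x) y r∈p-x-y
  nothing-else : Empty (p - x - y - r)
  nothing-else = ∣p∣≡0⇒Empty (ℕ.suc-injective (trans (sym (x∈p⇒∣p∣≡1+∣p-x∣ r∈p-x-y)) ∣p-x-y∣≡1))
  p⊆⁅x,y,r⁆ : p ⊆ ⁅ x ⁆ ∪ ⁅ y ⁆ ∪ ⁅ r ⁆
  p⊆⁅x,y,r⁆ {w} w∈p with w ≟ x | w ≟ y | w ≟ r
  ... | yes w≡x | _ | _ = Equivalence.from ∈-⁅,,⁆ (inj₁ w≡x)
  ... | no _ | yes w≡y | _ = Equivalence.from ∈-⁅,,⁆ (inj₂ (inj₁ w≡y))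
  ... | no _ | no _ | yes w≡r = Equivalence.from ∈-⁅,,⁆ (inj₂ (inj₂ w≡r))
  ... | no w≢x | no w≢y | no w≢r =
    ⊥-elim (nothing-else (w , x∈p∧x≢y⇒x∈p-y (x∈p∧x≢y⇒x∈p-y (x∈p∧x≢y⇒x∈p-y w∈p w≢x) w≢y) w≢r))
  ⁅x,y,r⁆⊆p : ⁅ x ⁆ ∪ ⁅ y ⁆ ∪ ⁅ r ⁆ ⊆ p
  ⁅x,y,r⁆⊆p w∈ with Equivalence.to ∈-⁅,,⁆ w∈
  ... | inj₁ refl = x∈p
  ... | inj₂ (inj₁ refl) = y∈p
  ... | inj₂ (inj₂ refl) = x∈p-y⇒x∈p p x r∈p-x

x∈tabulate⇔ : ∀ (f : Fin n → Bool) x → x ∈ tabulate f ⇔ f x ≡ true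
x∈tabulate⇔ f x = mk⇔ (λ x∈ → trans (sym (Vec.lookup∘tabulate f x)) (Vec.[]=⇒lookup x∈))
                      (λ fx≡true → Vec.lookup⇒[]= x (tabulate f) (trans (Vec.lookup∘tabulate f x) fx≡true))

¬Unique-of-length-suc : (xs : Vec (Fin n) (suc n)) → ¬ Unique xs
¬Unique-of-length-suc xs unique = ℕ.1+n≰n (injective⇒≤ (λ {i} {j} → lookup-injective unique i j))

injective⇒surjective : {f : Fin n → Fin n} → Injective _≡_ _≡_ f → ∀ y → ∃ λ x → f x ≡ y
injective⇒surjective {n} {f} f-injective y with any? (λ x → f x ≟ y)
... | yes hit = hit
... | no miss = contradiction (injective⇒≤ g-injective) ℕ.1+n≰n
  where
  g : Fin (suc n) → Fin n
  g zero = y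
  g (suc x) = f x
  g-injective : Injective _≡_ _≡_ g
  g-injective {zero} {zero} _ = refl
  g-injective {zero} {suc x} y≡fx = contradiction (x , sym y≡fx) miss
  g-injective {suc x} {zero} fx≡y = contradiction (x , fx≡y) miss
  g-injective {suc x} {suc x′} fx≡fx′ = cong suc (f-injective fx≡fx′)

-- Sign functions and point sets, relative to a third-point function t

TurnIdentity : (Fin 7 → Fin 7 → Fin 7) → (Fin 7 → Fin 7 → Sign) → Set
TurnIdentity t e = ∀ p q → p ≢ q → e p (t p q) ≡ opposite (e p q)

QuadrangleIdentityAt : (Fin 7 → Fin 7 → Fin 7) → Fin 7 → (Fin 7 → Fin 7 → Sign) → Set
QuadrangleIdentityAt t p e = ∀ q u v → p ≢ q → p ≢ u → p ≢ v → q ≢ u → q ≢ v → u ≢ v → t p q ≡ t u v →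
  e p q Sign.* e u v ≡ opposite (e p v Sign.* e u q)

IsLineOf : (Fin 7 → Fin 7 → Fin 7) → Subset 7 → Set
IsLineOf t S = ∃₂ λ x y → x ≢ y × S ≡ ⁅ x ⁆ ∪ ⁅ y ⁆ ∪ ⁅ t x y ⁆

IsTriangleOf : (Fin 7 → Fin 7 → Fin 7) → Subset 7 → Set
IsTriangleOf t S = ∃₂ λ x y → ∃ λ z → x ≢ y × x ≢ z × y ≢ z × z ≢ t x y × S ≡ ⁅ x ⁆ ∪ ⁅ y ⁆ ∪ ⁅ z ⁆

LinesAndTriangles : (Fin 7 → Fin 7 → Fin 7) → (F G : Fin 7 → Subset 7) → Set
LinesAndTriangles t F G =
  (∀ p → IsLineOf t (F p)) × (∀ p → IsTriangleOf t (G p)) ×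
  (∀ p q → p ≢ q → ∃! _≡_ λ k → p ∈ G k × q ∈ G k) ×
  (∀ k l → k ≢ l → ∃! _≡_ λ p → p ∈ G k × p ∈ G l)

-- The standard Fano plane

Coord : Set
Coord = Bool × Bool × Bool

infix 4 _≟ᶜ_

_≟ᶜ_ : (u v : Coord) → Dec (u ≡ v)
_≟ᶜ_ = Product.≡-dec Bool._≟_ (Product.≡-dec Bool._≟_ Bool._≟_)

-- The standard point p is the vector of binary digits of p + 1.
coords : Fin 7 → Coord
coords 0F = true  , false , false
coords 1F = false , true  , false
coords 2F = true  , true  , false
coords 3F = false , false , true
coords 4F = true  , false , true
coords 5F = false , true  , true
coords 6F = true  , true  , true

-- The inverse of coords, sending the zero vector (which is no point) to 0F.
point : Coord → Fin 7
point (true  , false , false) = 0F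
point (false , true  , false) = 1F
point (true  , true  , false) = 2F
point (false , false , true ) = 3F
point (true  , false , true ) = 4F
point (false , true  , true ) = 5F
point (true  , true  , true ) = 6F
point (false , false , false) = 0F

infixl 6 _⊻_ _⊕_

_⊻_ : Coord → Coord → Coord
(x , y , z) ⊻ (x′ , y′ , z′) = x xor x′ , y xor y′ , z xor z′

_⊕_ : Fin 7 → Fin 7 → Fin 7
p ⊕ q = point (coords p ⊻ coords q)

-- The lines of the standard plane are indexed by their normal vectors.
lineThrough : Fin 7 → Fin 7 → Fin 7
lineThrough p q = point (cross (coords p) (coords q))
  where
  cross : Coord → Coord → Coord
  cross (x , y , z) (x′ , y′ , z′) = (y ∧ z′) xor (z ∧ y′) , (z ∧ x′) xor (x ∧ z′) , (x ∧ y′) xor (y ∧ x′)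

-- A reference orientation: (p , q) is positive iff (p, q, p ⊕ q) is a rotation of an increasing triple.
ε₀ : Fin 7 → Fin 7 → Sign
ε₀ p q = if cyclic (toℕ p) (toℕ q) (toℕ (p ⊕ q)) then plus else minus
  where
  cyclic : ℕ → ℕ → ℕ → Bool
  cyclic i j k = ((i <ᵇ j) ∧ (j <ᵇ k)) ∨ ((j <ᵇ k) ∧ (k <ᵇ i)) ∨ ((k <ᵇ i) ∧ (i <ᵇ j))

induced : Vec Sign 7 → Fin 7 → Fin 7 → Sign
induced s p q = lookup s (lineThrough p q) Sign.* ε₀ p q

coords-⊕ : ∀ p q → p ≢ q → coords (p ⊕ q) ≡ coords p ⊻ coords q
coords-⊕ = from-yes (all? λ p → all? λ q → ¬? (p ≟ q) →-dec coords (p ⊕ q) ≟ᶜ coords p ⊻ coords q)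

coords-injective : ∀ p q → coords p ≡ coords q → p ≡ q
coords-injective = from-yes (all? λ p → all? λ q → coords p ≟ᶜ coords q →-dec p ≟ q)

coords≢0 : ∀ p → coords p ≢ (false , false , false)
coords≢0 = from-yes (all? λ p → ¬? (coords p ≟ᶜ (false , false , false)))

⊕-comm : ∀ p q → q ⊕ p ≡ p ⊕ q
⊕-comm = from-yes (all? λ p → all? λ q → q ⊕ p ≟ p ⊕ q)

p≢q⇒p≢p⊕q : ∀ p q → p ≢ q → p ≢ p ⊕ q
p≢q⇒p≢p⊕q = from-yes (all? λ p → all? λ q → ¬? (p ≟ q) →-dec ¬? (p ≟ p ⊕ q))

p≢q⇒q≢p⊕q : ∀ p q → p ≢ q → q ≢ p ⊕ q
p≢q⇒q≢p⊕q = from-yes (all? λ p → all? λ q → ¬? (p ≟ q) →-dec ¬? (q ≟ p ⊕ q))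

ε₀-antisym : IsMultiplicationFactor ε₀
ε₀-antisym = from-yes (all? λ p → all? λ q → ¬? (p ≟ q) →-dec ε₀ q p Sign.≟ opposite (ε₀ p q))

ε₀-turn : TurnIdentity _⊕_ ε₀
ε₀-turn = from-yes (all? λ p → all? λ q → ¬? (p ≟ q) →-dec ε₀ p (p ⊕ q) Sign.≟ opposite (ε₀ p q))

basePair : Fin 7 → Fin 7 × Fin 7
basePair 0F = 1F , 3F
basePair 1F = 0F , 3F
basePair 2F = 2F , 3F
basePair 3F = 0F , 1F
basePair 4F = 1F , 4F
basePair 5F = 0F , 5F
basePair 6F = 2F , 4F

Arrangement : Fin 7 → Fin 7 → Fin 7 × Fin 7 → Set
Arrangement p q xy =
  xy ≡ (p , q) ⊎ xy ≡ (q , p) ⊎ xy ≡ (p , p ⊕ q) ⊎ xy ≡ (p ⊕ q , p) ⊎ xy ≡ (q , p ⊕ q) ⊎ xy ≡ (p ⊕ q , q)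

basePair-arrangement : ∀ p q → p ≢ q → Arrangement p q (basePair (lineThrough p q))
basePair-arrangement = from-yes (all? λ p → all? λ q → ¬? (p ≟ q) →-dec
  (b p q ≟² (p , q) ⊎-dec b p q ≟² (q , p) ⊎-dec b p q ≟² (p , p ⊕ q) ⊎-dec
   b p q ≟² (p ⊕ q , p) ⊎-dec b p q ≟² (q , p ⊕ q) ⊎-dec b p q ≟² (p ⊕ q , q)))
  where
  b : Fin 7 → Fin 7 → Fin 7 × Fin 7
  b p q = basePair (lineThrough p q)
  infix 4 _≟²_
  _≟²_ : (u v : Fin 7 × Fin 7) → Dec (u ≡ v)
  _≟²_ = Product.≡-dec _≟_ _≟_

module _ {ρ : Fin 7 → Fin 7 → Sign}
         (ρ-sym : ∀ p q → p ≢ q → ρ q p ≡ ρ p q)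
         (ρ-turn : ∀ p q → p ≢ q → ρ p (p ⊕ q) ≡ ρ p q) where

  constant-on-lines : ∀ {p q x y} → p ≢ q → Arrangement p q (x , y) → ρ x y ≡ ρ p q
  constant-on-lines p≢q (inj₁ refl) = refl
  constant-on-lines {p} {q} p≢q (inj₂ (inj₁ refl)) = ρ-sym p q p≢q
  constant-on-lines {p} {q} p≢q (inj₂ (inj₂ (inj₁ refl))) = ρ-turn p q p≢q
  constant-on-lines {p} {q} p≢q (inj₂ (inj₂ (inj₂ (inj₁ refl)))) =
    trans (ρ-sym p (p ⊕ q) (p≢q⇒p≢p⊕q p q p≢q)) (ρ-turn p q p≢q)
  constant-on-lines {p} {q} p≢q (inj₂ (inj₂ (inj₂ (inj₂ (inj₁ refl))))) =
    trans (cong (ρ q) (sym (⊕-comm p q))) (trans (ρ-turn q p (p≢q ∘ sym)) (ρ-sym p q p≢q))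
  constant-on-lines {p} {q} p≢q (inj₂ (inj₂ (inj₂ (inj₂ (inj₂ refl))))) =
    trans (ρ-sym q (p ⊕ q) (p≢q⇒q≢p⊕q p q p≢q)) (constant-on-lines p≢q (inj₂ (inj₂ (inj₂ (inj₂ (inj₁ refl))))))

relative : (Fin 7 → Fin 7 → Sign) → Fin 7 → Fin 7 → Sign
relative e p q = e p q Sign.* ε₀ p q

orientation : (Fin 7 → Fin 7 → Sign) → Vec Sign 7
orientation e = tabulate (uncurry (relative e) ∘ basePair)

opposite-*-opposite : ∀ s t → opposite s Sign.* opposite t ≡ s Sign.* t
opposite-*-opposite plus t = Sign.opposite-involutive t
opposite-*-opposite minus t = refl

-- e relative to ε₀ is symmetric and unchanged by q ↦ p ⊕ q, hence constant on each line.
induced-orientation : ∀ e → IsMultiplicationFactor e → TurnIdentity _⊕_ e →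
                      ∀ p q → p ≢ q → e p q ≡ induced (orientation e) p q
induced-orientation e e-antisym e-turn p q p≢q = begin
  e p q                                 ≡⟨ relative-ε₀ p q ⟨
  relative e p q Sign.* ε₀ p q          ≡⟨ cong (Sign._* ε₀ p q) on-line ⟨
  uncurry (relative e) b Sign.* ε₀ p q  ≡⟨ cong (Sign._* ε₀ p q) (Vec.lookup∘tabulate signs (lineThrough p q)) ⟨
  induced (orientation e) p q           ∎
  where
  open ≡-Reasoning
  b : Fin 7 × Fin 7
  b = basePair (lineThrough p q)
  signs : Fin 7 → Sign
  signs = uncurry (relative e) ∘ basePair
  relative-sym : ∀ x y → x ≢ y → relative e y x ≡ relative e x y
  relative-sym x y x≢y =
    trans (cong₂ Sign._*_ (e-antisym x y x≢y) (ε₀-antisym x y x≢y)) (opposite-*-opposite (e x y) (ε₀ x y))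
  relative-turn : ∀ x y → x ≢ y → relative e x (x ⊕ y) ≡ relative e x y
  relative-turn x y x≢y =
    trans (cong₂ Sign._*_ (e-turn x y x≢y) (ε₀-turn x y x≢y)) (opposite-*-opposite (e x y) (ε₀ x y))
  relative-ε₀ : ∀ x y → relative e x y Sign.* ε₀ x y ≡ e x y
  relative-ε₀ x y = trans (Sign.*-assoc (e x y) (ε₀ x y) (ε₀ x y))
                          (trans (cong (e x y Sign.*_) (Sign.s*s≡+ (ε₀ x y))) (Sign.*-identityʳ (e x y)))
  on-line : uncurry (relative e) b ≡ relative e p q
  on-line = constant-on-lines relative-sym relative-turn p≢q (basePair-arrangement p q p≢q)

infix 4 _≟ˢ_

_≟ˢ_ : (S T : Subset 7) → Dec (S ≡ T)
_≟ˢ_ = Vec.≡-dec Bool._≟_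

unique? : {P : Fin 7 → Set} → (∀ x → Dec (P x)) → Dec (∃! _≡_ P)
unique? P? =
  map′ (λ (x , Px , unique) → x , Px , λ {y} → unique y) (λ (x , Px , unique) → x , Px , λ y → unique {y})
       (any? λ x → P? x ×-dec all? λ y → P? y →-dec x ≟ y)

isLineOf? : ∀ t S → Dec (IsLineOf t S)
isLineOf? t S = any? λ x → any? λ y → ¬? (x ≟ y) ×-dec S ≟ˢ ⁅ x ⁆ ∪ ⁅ y ⁆ ∪ ⁅ t x y ⁆

isTriangleOf? : ∀ t S → Dec (IsTriangleOf t S)
isTriangleOf? t S = any? λ x → any? λ y → any? λ z →
  ¬? (x ≟ y) ×-dec ¬? (x ≟ z) ×-dec ¬? (y ≟ z) ×-dec ¬? (z ≟ t x y) ×-dec S ≟ˢ ⁅ x ⁆ ∪ ⁅ y ⁆ ∪ ⁅ z ⁆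

linesAndTriangles? : ∀ t F G → Dec (LinesAndTriangles t F G)
linesAndTriangles? t F G =
  all? (isLineOf? t ∘ F) ×-dec all? (isTriangleOf? t ∘ G)
  ×-dec (all? λ p → all? λ q → ¬? (p ≟ q) →-dec unique? λ k → p ∈? G k ×-dec q ∈? G k)
  ×-dec (all? λ k → all? λ l → ¬? (k ≟ l) →-dec unique? λ p → p ∈? G k ×-dec p ∈? G l)

quadrangleIdentityAt? : ∀ p e → Dec (QuadrangleIdentityAt _⊕_ p e)
quadrangleIdentityAt? p e = all? λ q → all? λ u → all? λ v →
  ¬? (p ≟ q) →-dec ¬? (p ≟ u) →-dec ¬? (p ≟ v) →-dec ¬? (q ≟ u) →-dec ¬? (q ≟ v) →-dec ¬? (u ≟ v) →-dec
  p ⊕ q ≟ u ⊕ v →-dec e p q Sign.* e u v Sign.≟ opposite (e p v Sign.* e u q)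

∀-signs? : {P : Vec Sign n → Set} → (∀ s → Dec (P s)) → Dec (∀ s → P s)
∀-signs? {zero} P? = map′ (λ { P[] [] → P[] }) (λ ∀P → ∀P []) (P? [])
∀-signs? {suc n} P? =
  map′ (λ { (∀P₊ , ∀P₋) (plus ∷ s) → ∀P₊ s ; (∀P₊ , ∀P₋) (minus ∷ s) → ∀P₋ s })
       (λ ∀P → (λ s → ∀P (plus ∷ s)) , (λ s → ∀P (minus ∷ s)))
       (∀-signs? (λ s → P? (plus ∷ s)) ×-dec ∀-signs? (λ s → P? (minus ∷ s)))

-- The quadrangle identities at a single point already suffice, and keep the evaluation small.
standard-plane : ∀ s → QuadrangleIdentityAt _⊕_ 0F (induced s) →
  LinesAndTriangles _⊕_ (future (induced s)) (past (induced s)) ⊎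
  LinesAndTriangles _⊕_ (past (induced s)) (future (induced s))
standard-plane = from-yes (∀-signs? λ s → quadrangleIdentityAt? 0F (induced s) →-dec
  (linesAndTriangles? _⊕_ (future (induced s)) (past (induced s)) ⊎-dec
   linesAndTriangles? _⊕_ (past (induced s)) (future (induced s))))

-- future ε P = side isPlus ε P and past ε P = side (isPlus ∘ opposite) ε P
side : (Sign → Bool) → (Fin 7 → Fin 7 → Sign) → Fin 7 → Subset 7
side f ε P = tabulate λ Q → if does (Q ≟ P) then false else f (ε P Q)

-- The Fano cube of a Fano plane

module FanoGeometry {L : Fin 7 → Subset 7} (fp : IsFanoPlane L) where
  open IsFanoPlane fp
  open FanoCube fp using (third)
  open ≡-Reasoning

  private variable
    P Q R : Fin 7
    i : Fin 7

  line : P ≢ Q → Fin 7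
  line {P} {Q} P≢Q = proj₁ (two-points P Q P≢Q)

  ∈-line : (P≢Q : P ≢ Q) → P ∈ L (line P≢Q) × Q ∈ L (line P≢Q)
  ∈-line {P} {Q} P≢Q = proj₁ (proj₂ (two-points P Q P≢Q))

  line-unique : (P≢Q : P ≢ Q) → P ∈ L i → Q ∈ L i → line P≢Q ≡ i
  line-unique {P} {Q} P≢Q P∈ Q∈ = proj₂ (proj₂ (two-points P Q P≢Q)) (P∈ , Q∈)

  third-spec : (P≢Q : P ≢ Q) → third P Q ∈ L (line P≢Q) × third P Q ≢ P × third P Q ≢ Q
  third-spec {P} {Q} P≢Q with P ≟ Q
  ... | yes P≡Q = contradiction P≡Q P≢Q
  ... | no P≢Q′ with any? (λ R → (R ∈? L (proj₁ (two-points P Q P≢Q′))) ×-dec (¬? (R ≟ P)) ×-dec (¬? (R ≟ Q)))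
  ...   | yes (R , R∈ , R≢P , R≢Q) =
          subst (λ j → R ∈ L j) (sym (line-unique P≢Q (proj₁ (∈-line P≢Q′)) (proj₂ (∈-line P≢Q′)))) R∈ , R≢P , R≢Q
  ...   | no ∄R with z , z≢P , z≢Q , L≡ ← ∣p∣≡3⇒p≡⁅,,⁆ (line-size _) (proj₁ (∈-line P≢Q′)) (proj₂ (∈-line P≢Q′)) P≢Q′ =
          contradiction (z , subst (z ∈_) (sym L≡) (Equivalence.from ∈-⁅,,⁆ (inj₂ (inj₂ refl))) , z≢P , z≢Q) ∄R

  third≢ˡ : P ≢ Q → third P Q ≢ P
  third≢ˡ P≢Q = proj₁ (proj₂ (third-spec P≢Q))

  third≢ʳ : P ≢ Q → third P Q ≢ Q
  third≢ʳ P≢Q = proj₂ (proj₂ (third-spec P≢Q))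

  line≡⁅,,third⁆ : P ≢ Q → P ∈ L i → Q ∈ L i → L i ≡ ⁅ P ⁆ ∪ ⁅ Q ⁆ ∪ ⁅ third P Q ⁆
  line≡⁅,,third⁆ {P} {Q} {i} P≢Q P∈ Q∈ with z , z≢P , z≢Q , Li≡ ← ∣p∣≡3⇒p≡⁅,,⁆ (line-size i) P∈ Q∈ P≢Q =
    subst (λ R → L i ≡ ⁅ P ⁆ ∪ ⁅ Q ⁆ ∪ ⁅ R ⁆) (sym third≡z) Li≡
    where
    third∈ : third P Q ∈ L i
    third∈ = subst (λ j → third P Q ∈ L j) (line-unique P≢Q P∈ Q∈) (proj₁ (third-spec P≢Q))
    third≡z : third P Q ≡ z
    third≡z with Equivalence.to ∈-⁅,,⁆ (subst (third P Q ∈_) Li≡ third∈)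
    ... | inj₁ t≡P = contradiction t≡P (third≢ˡ P≢Q)
    ... | inj₂ (inj₁ t≡Q) = contradiction t≡Q (third≢ʳ P≢Q)
    ... | inj₂ (inj₂ t≡z) = t≡z

  third-unique : P ≢ Q → P ∈ L i → Q ∈ L i → R ∈ L i → R ≢ P → R ≢ Q → third P Q ≡ R
  third-unique P≢Q P∈ Q∈ R∈ R≢P R≢Q with Equivalence.to ∈-⁅,,⁆ (subst (_ ∈_) (line≡⁅,,third⁆ P≢Q P∈ Q∈) R∈)
  ... | inj₁ R≡P = contradiction R≡P R≢P
  ... | inj₂ (inj₁ R≡Q) = contradiction R≡Q R≢Q
  ... | inj₂ (inj₂ R≡t) = sym R≡t

  third-comm : P ≢ Q → third Q P ≡ third P Q
  third-comm P≢Q =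
    third-unique (P≢Q ∘ sym) (proj₂ (∈-line P≢Q)) (proj₁ (∈-line P≢Q)) (proj₁ (third-spec P≢Q))
                 (third≢ʳ P≢Q) (third≢ˡ P≢Q)

  third-involutive : P ≢ Q → third P (third P Q) ≡ Q
  third-involutive P≢Q =
    third-unique (third≢ˡ P≢Q ∘ sym) (proj₁ (∈-line P≢Q)) (proj₁ (third-spec P≢Q)) (proj₂ (∈-line P≢Q))
                 (P≢Q ∘ sym) (third≢ʳ P≢Q ∘ sym)

  third-cancel : P ≢ Q → P ≢ R → third P Q ≡ third P R → Q ≡ R
  third-cancel {P} P≢Q P≢R tQ≡tR =
    trans (sym (third-involutive P≢Q)) (trans (cong (third P) tQ≡tR) (third-involutive P≢R))

  third-swap : P ≢ Q → third P Q ≡ R → third P R ≡ Q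
  third-swap {P} P≢Q tPQ≡R = trans (cong (third P) (sym tPQ≡R)) (third-involutive P≢Q)

  -- The eight points x, y, z, x+y, y+z, x+z, x+(y+z), (x+y)+z of Fin 7 cannot be pairwise
  -- distinct, and all pairs other than the last one are.
  third-assoc : ∀ {x y z} → x ≢ y → z ≢ x → z ≢ y → z ≢ third x y →
                third (third x y) z ≡ third x (third y z)
  third-assoc {x} {y} {z} x≢y z≢x z≢y z≢xy with third (third x y) z ≟ third x (third y z)
  ... | yes Y≡X = Y≡X
  ... | no Y≢X = contradiction distinct (¬Unique-of-length-suc (x ∷ y ∷ z ∷ xy ∷ yz ∷ xz ∷ X ∷ Y ∷ []))
    where
    xy yz xz X Y : Fin 7
    xy = third x y
    yz = third y z
    xz = third x z
    X = third x yz
    Y = third xy z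
    x≢z : x ≢ z
    x≢z = z≢x ∘ sym
    y≢z : y ≢ z
    y≢z = z≢y ∘ sym
    xy≢z : xy ≢ z
    xy≢z = z≢xy ∘ sym
    x≢yz : x ≢ yz
    x≢yz x≡yz = z≢xy (sym (trans (sym (third-comm x≢y)) (third-swap y≢z (sym x≡yz))))
    xy≢yz : xy ≢ yz
    xy≢yz xy≡yz = x≢z (third-cancel (x≢y ∘ sym) y≢z (trans (third-comm x≢y) xy≡yz))
    xz≢yz : xz ≢ yz
    xz≢yz xz≡yz =
      x≢y (third-cancel (x≢z ∘ sym) (y≢z ∘ sym) (trans (third-comm x≢z) (trans xz≡yz (sym (third-comm y≢z)))))
    distinct : Unique (x ∷ y ∷ z ∷ xy ∷ yz ∷ xz ∷ X ∷ Y ∷ [])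
    distinct =
      (x≢y ∷ x≢z ∷ third≢ˡ x≢y ∘ sym ∷ x≢yz ∷ third≢ˡ x≢z ∘ sym ∷ third≢ˡ x≢yz ∘ sym ∷
        (λ x≡Y → z≢y (trans (sym (third-swap xy≢z (sym x≡Y)))
                            (trans (third-comm (third≢ˡ x≢y ∘ sym)) (third-involutive x≢y)))) ∷ []) ∷
      (y≢z ∷ third≢ʳ x≢y ∘ sym ∷ third≢ˡ y≢z ∘ sym ∷
        (λ y≡xz → z≢xy (sym (third-swap x≢z (sym y≡xz)))) ∷
        (λ y≡X → xy≢yz (third-swap x≢yz (sym y≡X))) ∷
        (λ y≡Y → z≢x (trans (sym (third-swap xy≢z (sym y≡Y))) (trans (third-comm (third≢ʳ x≢y ∘ sym))
                   (trans (cong (third y) (sym (third-comm x≢y))) (third-involutive (x≢y ∘ sym)))))) ∷ []) ∷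
      (z≢xy ∷ third≢ʳ y≢z ∘ sym ∷ third≢ʳ x≢z ∘ sym ∷
        (λ z≡X → xz≢yz (third-swap x≢yz (sym z≡X))) ∷ third≢ʳ xy≢z ∘ sym ∷ []) ∷
      (xy≢yz ∷ (λ xy≡xz → y≢z (third-cancel x≢y x≢z xy≡xz)) ∷
        (λ xy≡X → third≢ˡ y≢z (sym (third-cancel x≢y x≢yz xy≡X))) ∷ third≢ˡ xy≢z ∘ sym ∷ []) ∷
      ((xz≢yz ∘ sym) ∷ third≢ʳ x≢yz ∘ sym ∷
        (λ yz≡Y → third≢ʳ x≢y (sym (third-cancel z≢y z≢xy
                    (trans (third-comm y≢z) (trans yz≡Y (sym (third-comm xy≢z))))))) ∷ []) ∷
      ((λ xz≡X → third≢ʳ y≢z (sym (third-cancel x≢z x≢yz xz≡X))) ∷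
        (λ xz≡Y → third≢ˡ x≢y (sym (third-cancel z≢x z≢xy
                    (trans (third-comm x≢z) (trans xz≡Y (sym (third-comm xy≢z))))))) ∷ []) ∷
      ((Y≢X ∘ sym) ∷ []) ∷ [] ∷ []

  -- An explicit decision instead of with, so that lemmas can case on P ≟ Q without also
  -- abstracting the test P ≟ Q inside third.
  sum-of-points : ∀ P Q → Dec (P ≡ Q) → V
  sum-of-points P Q (yes _) = nothing
  sum-of-points P Q (no _) = just (third P Q)

  infixl 6 _∔_
  _∔_ : V → V → V
  nothing ∔ v = v
  just P ∔ nothing = just P
  just P ∔ just Q = sum-of-points P Q (P ≟ Q)

  ∔-identityʳ : ∀ u → u ∔ nothing ≡ u
  ∔-identityʳ nothing = refl
  ∔-identityʳ (just P) = refl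

  ∔-self : ∀ u → u ∔ u ≡ nothing
  ∔-self nothing = refl
  ∔-self (just P) = sum-of-equal (P ≟ P)
    where
    sum-of-equal : (d : Dec (P ≡ P)) → sum-of-points P P d ≡ nothing
    sum-of-equal (yes _) = refl
    sum-of-equal (no P≢P) = contradiction refl P≢P

  ∔-just : P ≢ Q → just P ∔ just Q ≡ just (third P Q)
  ∔-just {P} {Q} P≢Q = sum-of-distinct (P ≟ Q)
    where
    sum-of-distinct : (d : Dec (P ≡ Q)) → sum-of-points P Q d ≡ just (third P Q)
    sum-of-distinct (yes P≡Q) = contradiction P≡Q P≢Q
    sum-of-distinct (no _) = refl

  ∔-comm : ∀ u v → u ∔ v ≡ v ∔ u
  ∔-comm nothing v = sym (∔-identityʳ v)
  ∔-comm (just P) nothing = refl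
  ∔-comm (just P) (just Q) = points (P ≟ Q)
    where
    points : Dec (P ≡ Q) → just P ∔ just Q ≡ just Q ∔ just P
    points (yes refl) = refl
    points (no P≢Q) = trans (∔-just P≢Q) (trans (cong just (sym (third-comm P≢Q))) (sym (∔-just (P≢Q ∘ sym))))

  ∔-cancelˡ : ∀ u v → u ∔ (u ∔ v) ≡ v
  ∔-cancelˡ nothing v = refl
  ∔-cancelˡ (just P) nothing = ∔-self (just P)
  ∔-cancelˡ (just P) (just Q) = points (P ≟ Q)
    where
    points : Dec (P ≡ Q) → just P ∔ (just P ∔ just Q) ≡ just Q
    points (yes refl) = trans (cong (just P ∔_) (∔-self (just P))) refl
    points (no P≢Q) = trans (cong (just P ∔_) (∔-just P≢Q))
                        (trans (∔-just (third≢ˡ P≢Q ∘ sym)) (cong just (third-involutive P≢Q)))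

  ∔≡nothing⇒≡ : ∀ u v → u ∔ v ≡ nothing → u ≡ v
  ∔≡nothing⇒≡ u v u+v≡0 = trans (sym (∔-identityʳ u)) (trans (cong (u ∔_) (sym u+v≡0)) (∔-cancelˡ u v))

  ∔-assoc-repeated : ∀ u w → (u ∔ u) ∔ w ≡ u ∔ (u ∔ w)
  ∔-assoc-repeated u w = trans (cong (_∔ w) (∔-self u)) (sym (∔-cancelˡ u w))

  ∔-assoc-returning : ∀ u v → (u ∔ v) ∔ u ≡ u ∔ (v ∔ u)
  ∔-assoc-returning u v = trans (∔-comm (u ∔ v) u) (cong (u ∔_) (∔-comm u v))

  ∔-assoc-doubled : ∀ u v → (u ∔ v) ∔ v ≡ u ∔ (v ∔ v)
  ∔-assoc-doubled u v = begin
    (u ∔ v) ∔ v  ≡⟨ cong (_∔ v) (∔-comm u v) ⟩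
    (v ∔ u) ∔ v  ≡⟨ ∔-comm (v ∔ u) v ⟩
    v ∔ (v ∔ u)  ≡⟨ ∔-cancelˡ v u ⟩
    u            ≡⟨ ∔-identityʳ u ⟨
    u ∔ nothing  ≡⟨ cong (u ∔_) (∔-self v) ⟨
    u ∔ (v ∔ v)  ∎

  ∔-assoc-cancelling : ∀ u v → (u ∔ v) ∔ (u ∔ v) ≡ u ∔ (v ∔ (u ∔ v))
  ∔-assoc-cancelling u v = begin
    (u ∔ v) ∔ (u ∔ v)  ≡⟨ ∔-self (u ∔ v) ⟩
    nothing            ≡⟨ ∔-self u ⟨
    u ∔ u              ≡⟨ cong (u ∔_) (∔-cancelˡ v u) ⟨
    u ∔ (v ∔ (v ∔ u))  ≡⟨ cong (λ w → u ∔ (v ∔ w)) (∔-comm v u) ⟩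
    u ∔ (v ∔ (u ∔ v))  ∎

  ∔-assoc : ∀ u v w → (u ∔ v) ∔ w ≡ u ∔ (v ∔ w)
  ∔-assoc nothing v w = refl
  ∔-assoc (just P) nothing w = refl
  ∔-assoc (just P) (just Q) nothing = ∔-identityʳ (just P ∔ just Q)
  ∔-assoc (just P) (just Q) (just R) = points (P ≟ Q) (R ≟ P) (R ≟ Q) (R ≟ third P Q)
    where
    points : Dec (P ≡ Q) → Dec (R ≡ P) → Dec (R ≡ Q) → Dec (R ≡ third P Q) →
             (just P ∔ just Q) ∔ just R ≡ just P ∔ (just Q ∔ just R)
    points (yes refl) _ _ _ = ∔-assoc-repeated (just P) (just R)
    points (no _) (yes refl) _ _ = ∔-assoc-returning (just P) (just Q)
    points (no _) (no _) (yes refl) _ = ∔-assoc-doubled (just P) (just Q)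
    points (no P≢Q) (no _) (no _) (yes refl) =
      subst (λ w → (just P ∔ just Q) ∔ w ≡ just P ∔ (just Q ∔ w)) (∔-just P≢Q) (∔-assoc-cancelling (just P) (just Q))
    points (no P≢Q) (no R≢P) (no R≢Q) (no R≢PQ) = begin
      (just P ∔ just Q) ∔ just R  ≡⟨ cong (_∔ just R) (∔-just P≢Q) ⟩
      just (third P Q) ∔ just R   ≡⟨ ∔-just (R≢PQ ∘ sym) ⟩
      just (third (third P Q) R)  ≡⟨ cong just (third-assoc P≢Q R≢P R≢Q R≢PQ) ⟩
      just (third P (third Q R))  ≡⟨ ∔-just P≢QR ⟨
      just P ∔ just (third Q R)   ≡⟨ cong (just P ∔_) (∔-just (R≢Q ∘ sym)) ⟨
      just P ∔ (just Q ∔ just R)  ∎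
      where
      P≢QR : P ≢ third Q R
      P≢QR P≡QR = R≢PQ (trans (sym (third-swap (R≢Q ∘ sym) (sym P≡QR))) (third-comm P≢Q))

  ∔-interchange : ∀ u v u′ v′ → (u ∔ v) ∔ (u′ ∔ v′) ≡ (u ∔ u′) ∔ (v ∔ v′)
  ∔-interchange u v u′ v′ = begin
    (u ∔ v) ∔ (u′ ∔ v′)  ≡⟨ ∔-assoc u v (u′ ∔ v′) ⟩
    u ∔ (v ∔ (u′ ∔ v′))  ≡⟨ cong (u ∔_) (∔-assoc v u′ v′) ⟨
    u ∔ ((v ∔ u′) ∔ v′)  ≡⟨ cong (λ w → u ∔ (w ∔ v′)) (∔-comm v u′) ⟩
    u ∔ ((u′ ∔ v) ∔ v′)  ≡⟨ cong (u ∔_) (∔-assoc u′ v v′) ⟩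
    u ∔ (u′ ∔ (v ∔ v′))  ≡⟨ ∔-assoc u u′ (v ∔ v′) ⟨
    (u ∔ u′) ∔ (v ∔ v′)  ∎

  ∔-injectiveʳ : ∀ u {v w} → u ∔ v ≡ u ∔ w → v ≡ w
  ∔-injectiveʳ u {v} {w} u∔v≡u∔w = trans (sym (∔-cancelˡ u v)) (trans (cong (u ∔_) u∔v≡u∔w) (∔-cancelˡ u w))

  ∔-exchange : ∀ a b c d → a ∔ c ≡ b ∔ d → a ∔ d ≡ b ∔ c
  ∔-exchange a b c d a∔c≡b∔d = begin
    a ∔ d              ≡⟨ cong (a ∔_) (∔-cancelˡ c d) ⟨
    a ∔ (c ∔ (c ∔ d))  ≡⟨ ∔-assoc a c (c ∔ d) ⟨
    (a ∔ c) ∔ (c ∔ d)  ≡⟨ cong (_∔ (c ∔ d)) a∔c≡b∔d ⟩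
    (b ∔ d) ∔ (c ∔ d)  ≡⟨ cong ((b ∔ d) ∔_) (∔-comm c d) ⟩
    (b ∔ d) ∔ (d ∔ c)  ≡⟨ ∔-assoc b d (d ∔ c) ⟩
    b ∔ (d ∔ (d ∔ c))  ≡⟨ cong (b ∔_) (∔-cancelˡ d c) ⟩
    b ∔ c              ∎

  infixr 7 _·_
  _·_ : Bool → V → V
  true · u = u
  false · u = nothing

  ·-xor : ∀ x y u → (x xor y) · u ≡ x · u ∔ y · u
  ·-xor false false u = refl
  ·-xor false true u = refl
  ·-xor true false u = sym (∔-identityʳ u)
  ·-xor true true u = sym (∔-self u)

  avoid : (R : Fin 7) → ∃ λ D → D ≢ 0F × D ≢ 1F × D ≢ R
  avoid R with R ≟ 2F
  ... | yes refl = 3F , (λ ()) , (λ ()) , (λ ())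
  ... | no R≢2 = 2F , (λ ()) , (λ ()) , R≢2 ∘ sym

  -- off the line through 0F and 1F, so that 0F, 1F, D is a basis of the Fano cube
  D : Fin 7
  D = proj₁ (avoid (third 0F 1F))

  D≢0 : D ≢ 0F
  D≢0 = proj₁ (proj₂ (avoid (third 0F 1F)))

  D≢1 : D ≢ 1F
  D≢1 = proj₁ (proj₂ (proj₂ (avoid (third 0F 1F))))

  D≢01 : D ≢ third 0F 1F
  D≢01 = proj₂ (proj₂ (proj₂ (avoid (third 0F 1F))))

  span : Coord → V
  span (x , y , z) = x · just 0F ∔ y · just 1F ∔ z · just D

  span-⊻ : ∀ c c′ → span (c ⊻ c′) ≡ span c ∔ span c′
  span-⊻ (x , y , z) (x′ , y′ , z′) = begin
    (x xor x′) · a ∔ (y xor y′) · b ∔ (z xor z′) · d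
      ≡⟨ cong₂ _∔_ (cong₂ _∔_ (·-xor x x′ a) (·-xor y y′ b)) (·-xor z z′ d) ⟩
    ((x · a ∔ x′ · a) ∔ (y · b ∔ y′ · b)) ∔ (z · d ∔ z′ · d)
      ≡⟨ cong (_∔ (z · d ∔ z′ · d)) (∔-interchange (x · a) (x′ · a) (y · b) (y′ · b)) ⟩
    ((x · a ∔ y · b) ∔ (x′ · a ∔ y′ · b)) ∔ (z · d ∔ z′ · d)
      ≡⟨ ∔-interchange (x · a ∔ y · b) (x′ · a ∔ y′ · b) (z · d) (z′ · d) ⟩
    (x · a ∔ y · b ∔ z · d) ∔ (x′ · a ∔ y′ · b ∔ z′ · d) ∎
    where
    a b d : V
    a = just 0F
    b = just 1F
    d = just D

  span≡nothing : ∀ c → span c ≡ nothing → c ≡ (false , false , false)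
  span≡nothing (false , false , false) _ = refl
  span≡nothing (true , false , false) ()
  span≡nothing (false , true , false) ()
  span≡nothing (true , true , false) ()
  span≡nothing (false , false , true) ()
  span≡nothing (true , false , true) 0∔D≡0 = contradiction (sym (Maybe.just-injective (∔≡nothing⇒≡ _ _ 0∔D≡0))) D≢0
  span≡nothing (false , true , true) 1∔D≡0 = contradiction (sym (Maybe.just-injective (∔≡nothing⇒≡ _ _ 1∔D≡0))) D≢1
  span≡nothing (true , true , true) 01∔D≡0 = contradiction (sym (Maybe.just-injective (∔≡nothing⇒≡ _ _ 01∔D≡0))) D≢01

  xor≡false⇒≡ : ∀ x y → x xor y ≡ false → x ≡ y
  xor≡false⇒≡ false false _ = refl
  xor≡false⇒≡ true true _ = refl

  span-injective : ∀ c c′ → span c ≡ span c′ → c ≡ c′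
  span-injective c@(x , y , z) c′@(x′ , y′ , z′) span≡ =
    cong₂ _,_ (xor≡false⇒≡ x x′ (cong proj₁ c⊻c′≡0))
      (cong₂ _,_ (xor≡false⇒≡ y y′ (cong (proj₁ ∘ proj₂) c⊻c′≡0)) (xor≡false⇒≡ z z′ (cong (proj₂ ∘ proj₂) c⊻c′≡0)))
    where
    c⊻c′≡0 : c ⊻ c′ ≡ (false , false , false)
    c⊻c′≡0 = span≡nothing (c ⊻ c′) (trans (span-⊻ c c′) (trans (cong (span c ∔_) (sym span≡)) (∔-self (span c))))

  toPoint : (u : V) → u ≢ nothing → Fin 7
  toPoint (just P) _ = P
  toPoint nothing u≢0 = contradiction refl u≢0

  just-toPoint : ∀ u (u≢0 : u ≢ nothing) → just (toPoint u u≢0) ≡ u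
  just-toPoint (just P) _ = refl
  just-toPoint nothing u≢0 = contradiction refl u≢0

  -- The isomorphism from the standard plane: coordinates (x, y, z) go to x·0F + y·1F + z·D.
  σ : Fin 7 → Fin 7
  σ p = toPoint (span (coords p)) (coords≢0 p ∘ span≡nothing (coords p))

  just-σ : ∀ p → just (σ p) ≡ span (coords p)
  just-σ p = just-toPoint (span (coords p)) _

  σ-injective : Injective _≡_ _≡_ σ
  σ-injective {p} {q} σp≡σq =
    coords-injective p q (span-injective (coords p) (coords q)
      (trans (sym (just-σ p)) (trans (cong just σp≡σq) (just-σ q))))

  σ-surjective : ∀ P → ∃ λ p → σ p ≡ P
  σ-surjective = injective⇒surjective σ-injective

  σ-⊕ : ∀ {p q} → p ≢ q → σ (p ⊕ q) ≡ third (σ p) (σ q)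
  σ-⊕ {p} {q} p≢q = Maybe.just-injective (begin
    just (σ (p ⊕ q))                 ≡⟨ just-σ (p ⊕ q) ⟩
    span (coords (p ⊕ q))            ≡⟨ cong span (coords-⊕ p q p≢q) ⟩
    span (coords p ⊻ coords q)       ≡⟨ span-⊻ (coords p) (coords q) ⟩
    span (coords p) ∔ span (coords q) ≡⟨ cong₂ _∔_ (just-σ p) (just-σ q) ⟨
    just (σ p) ∔ just (σ q)          ≡⟨ ∔-just (p≢q ∘ σ-injective) ⟩
    just (third (σ p) (σ q))         ∎)

  private variable
    S : Subset 7

  isLine⁺ : IsLineOf third S → IsLine L S
  isLine⁺ (x , y , x≢y , S≡) = line x≢y , trans (line≡⁅,,third⁆ x≢y (proj₁ (∈-line x≢y)) (proj₂ (∈-line x≢y))) (sym S≡)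

  isTriangle⁺ : IsTriangleOf third S → IsTriangle L S
  isTriangle⁺ {S} (x , y , z , x≢y , x≢z , y≢z , z≢xy , S≡) =
    subst (λ T → ∣ T ∣ ≡ 3) (sym S≡) (∣⁅,,⁆∣≡3 x≢y x≢z y≢z) , not-a-line
    where
    not-a-line : ¬ IsLine L S
    not-a-line (i , Li≡S) with Equivalence.to ∈-⁅,,⁆ (subst (third x y ∈_) (trans Li≡S S≡) xy∈Li)
      where
      ∈Li : ∀ {w} → w ≡ x ⊎ w ≡ y ⊎ w ≡ z → w ∈ L i
      ∈Li w≡ = subst (_ ∈_) (sym (trans Li≡S S≡)) (Equivalence.from ∈-⁅,,⁆ w≡)
      xy∈Li : third x y ∈ L i
      xy∈Li = subst (third x y ∈_) (sym (line≡⁅,,third⁆ x≢y (∈Li (inj₁ refl)) (∈Li (inj₂ (inj₁ refl)))))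
                (Equivalence.from ∈-⁅,,⁆ (inj₂ (inj₂ refl)))
    ... | inj₁ xy≡x = third≢ˡ x≢y xy≡x
    ... | inj₂ (inj₁ xy≡y) = third≢ʳ x≢y xy≡y
    ... | inj₂ (inj₂ xy≡z) = z≢xy (sym xy≡z)

  conclusion : ∀ {F G} → LinesAndTriangles third F G →
               (∀ P → IsLine L (F P)) × (∀ P → IsTriangle L (G P)) × IsFanoPlane G
  conclusion {F} {G} (lines , triangles , two-points′ , two-lines′) =
    isLine⁺ ∘ lines , isTriangle⁺ ∘ triangles ,
    record { line-size = proj₁ ∘ isTriangle⁺ ∘ triangles ; line-inj = G-injective
           ; two-points = two-points′ ; two-lines = two-lines′ }
    where
    G-injective : ∀ P Q → G P ≡ G Q → P ≡ Q
    G-injective P Q GP≡GQ with P ≟ Q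
    ... | yes P≡Q = P≡Q
    ... | no P≢Q with x , y , z , x≢y , _ , _ , _ , GP≡ ← triangles P =
      contradiction (trans (sym (common≡ x (inj₁ refl))) (common≡ y (inj₂ (inj₁ refl)))) x≢y
      where
      common≡ : ∀ w → w ≡ x ⊎ w ≡ y ⊎ w ≡ z → proj₁ (two-lines′ P Q P≢Q) ≡ w
      common≡ w w≡ = proj₂ (proj₂ (two-lines′ P Q P≢Q)) (w∈GP , subst (w ∈_) GP≡GQ w∈GP)
        where
        w∈GP : w ∈ G P
        w∈GP = subst (w ∈_) (sym GP≡) (Equivalence.from ∈-⁅,,⁆ w≡)

  infix 4 _≗σ_
  _≗σ_ : Subset 7 → Subset 7 → Set
  S ≗σ T = ∀ w → σ w ∈ S ⇔ w ∈ T

  ∀-σ : {Φ : Fin 7 → Set} → (∀ p → Φ (σ p)) → ∀ P → Φ P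
  ∀-σ {Φ} Φσ P = subst Φ (proj₂ (σ-surjective P)) (Φσ (proj₁ (σ-surjective P)))

  ≗σ-unique : ∀ {S S′ T} → S ≗σ T → S′ ≗σ T → S ≡ S′
  ≗σ-unique S≗T S′≗T = ⊆-antisym (via S≗T S′≗T _) (via S′≗T S≗T _)
    where
    via : ∀ {A B T} → A ≗σ T → B ≗σ T → ∀ W → W ∈ A → W ∈ B
    via {A} {B} A≗T B≗T = ∀-σ λ w → Equivalence.from (B≗T w) ∘ Equivalence.to (A≗T w)

  ⁅,,⁆-≗σ : ∀ x y z → ⁅ σ x ⁆ ∪ ⁅ σ y ⁆ ∪ ⁅ σ z ⁆ ≗σ ⁅ x ⁆ ∪ ⁅ y ⁆ ∪ ⁅ z ⁆
  ⁅,,⁆-≗σ x y z w = mk⇔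
    (Equivalence.from ∈-⁅,,⁆ ∘ Sum.map σ-injective (Sum.map σ-injective σ-injective) ∘ Equivalence.to ∈-⁅,,⁆)
    (Equivalence.from ∈-⁅,,⁆ ∘ Sum.map (cong σ) (Sum.map (cong σ) (cong σ)) ∘ Equivalence.to ∈-⁅,,⁆)

  ∃!-σ : {Φ Φ′ : Fin 7 → Set} → (∀ k → Φ (σ k) ⇔ Φ′ k) → ∃! _≡_ Φ′ → ∃! _≡_ Φ
  ∃!-σ {Φ} Φ⇔Φ′ (k , Φ′k , unique) =
    σ k , Equivalence.from (Φ⇔Φ′ k) Φ′k , λ {K} → ∀-σ (λ l Φσl → cong σ (unique (Equivalence.to (Φ⇔Φ′ l) Φσl))) K

  transport : ∀ {F G F′ G′} → (∀ p → F (σ p) ≗σ F′ p) → (∀ p → G (σ p) ≗σ G′ p) →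
              LinesAndTriangles _⊕_ F′ G′ → LinesAndTriangles third F G
  transport {F} {G} {F′} {G′} F≗F′ G≗G′ (lines , triangles , two-points′ , two-lines′) =
    ∀-σ line-at , ∀-σ triangle-at ,
    ∀-σ (λ p → ∀-σ λ q σp≢σq → ∃!-σ (λ k → G≗G′ k p ×-⇔ G≗G′ k q) (two-points′ p q (σp≢σq ∘ cong σ))) ,
    ∀-σ (λ k → ∀-σ λ l σk≢σl → ∃!-σ (λ p → G≗G′ k p ×-⇔ G≗G′ l p) (two-lines′ k l (σk≢σl ∘ cong σ)))
    where
    line-at : ∀ p → IsLineOf third (F (σ p))
    line-at p with x , y , x≢y , F′p≡ ← lines p =
      σ x , σ y , x≢y ∘ σ-injective ,
      ≗σ-unique (subst (F (σ p) ≗σ_) F′p≡ (F≗F′ p))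
                (subst (λ R → ⁅ σ x ⁆ ∪ ⁅ σ y ⁆ ∪ ⁅ R ⁆ ≗σ _) (σ-⊕ x≢y) (⁅,,⁆-≗σ x y (x ⊕ y)))
    triangle-at : ∀ p → IsTriangleOf third (G (σ p))
    triangle-at p with x , y , z , x≢y , x≢z , y≢z , z≢xy , G′p≡ ← triangles p =
      σ x , σ y , σ z , x≢y ∘ σ-injective , x≢z ∘ σ-injective , y≢z ∘ σ-injective ,
      (λ σz≡ → z≢xy (σ-injective (trans σz≡ (sym (σ-⊕ x≢y))))) ,
      ≗σ-unique (subst (G (σ p) ≗σ_) G′p≡ (G≗G′ p)) (⁅,,⁆-≗σ x y z)

  side-≗σ : ∀ {ε e : Fin 7 → Fin 7 → Sign} (f : Sign → Bool) → (∀ p w → w ≢ p → ε (σ p) (σ w) ≡ e p w) →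
            ∀ p → side f ε (σ p) ≗σ side f e p
  side-≗σ {ε} {e} f ε≡e p w =
    mk⇔ (λ σw∈ → Equivalence.from (x∈tabulate⇔ G w) (trans (sym entry) (Equivalence.to (x∈tabulate⇔ F (σ w)) σw∈)))
        (λ w∈ → Equivalence.from (x∈tabulate⇔ F (σ w)) (trans entry (Equivalence.to (x∈tabulate⇔ G w) w∈)))
    where
    F G : Fin 7 → Bool
    F Q = if does (Q ≟ σ p) then false else f (ε (σ p) Q)
    G v = if does (v ≟ p) then false else f (e p v)
    entry : F (σ w) ≡ G w
    entry with w ≟ p
    ... | yes refl = cong (λ b → if b then false else f (ε (σ w) (σ w))) (dec-true (σ w ≟ σ w) refl)
    ... | no w≢p =
      trans (cong (λ b → if b then false else f (ε (σ p) (σ w))) (dec-false (σ w ≟ σ p) (w≢p ∘ σ-injective)))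
            (cong f (ε≡e p w w≢p))

  dichotomy : ∀ {ε} → IsMultiplicationFactor ε → TurnIdentity third ε → (∀ P → QuadrangleIdentityAt third P ε) →
    ((∀ P → IsLine L (future ε P)) × (∀ P → IsTriangle L (past ε P)) × IsFanoPlane (past ε)) ⊎
    ((∀ P → IsLine L (past ε P)) × (∀ P → IsTriangle L (future ε P)) × IsFanoPlane (future ε))
  dichotomy {ε} antisymmetric turn quadrangle =
    Sum.map (conclusion ∘ transport future≗ past≗) (conclusion ∘ transport past≗ future≗)
            (standard-plane (orientation e) quadrangles-at-0)
    where
    e : Fin 7 → Fin 7 → Sign
    e p q = ε (σ p) (σ q)
    e≡induced : ∀ p q → p ≢ q → e p q ≡ induced (orientation e) p q
    e≡induced = induced-orientation e
      (λ p q p≢q → antisymmetric (σ p) (σ q) (p≢q ∘ σ-injective))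
      (λ p q p≢q → trans (cong (ε (σ p)) (σ-⊕ p≢q)) (turn (σ p) (σ q) (p≢q ∘ σ-injective)))
    quadrangles-at-0 : QuadrangleIdentityAt _⊕_ 0F (induced (orientation e))
    quadrangles-at-0 q u v 0≢q 0≢u 0≢v q≢u q≢v u≢v 0⊕q≡u⊕v = begin
      s 0F q Sign.* s u v             ≡⟨ cong₂ Sign._*_ (e≡induced 0F q 0≢q) (e≡induced u v u≢v) ⟨
      e 0F q Sign.* e u v             ≡⟨ quadrangle (σ 0F) (σ q) (σ u) (σ v)
                                          (0≢q ∘ σ-injective) (0≢u ∘ σ-injective) (0≢v ∘ σ-injective)
                                          (q≢u ∘ σ-injective) (q≢v ∘ σ-injective) (u≢v ∘ σ-injective)
                                          (trans (sym (σ-⊕ 0≢q)) (trans (cong σ 0⊕q≡u⊕v) (σ-⊕ u≢v))) ⟩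
      opposite (e 0F v Sign.* e u q)
        ≡⟨ cong opposite (cong₂ Sign._*_ (e≡induced 0F v 0≢v) (e≡induced u q (q≢u ∘ sym))) ⟩
      opposite (s 0F v Sign.* s u q)  ∎
      where
      s : Fin 7 → Fin 7 → Sign
      s = induced (orientation e)
    future≗ : ∀ p → future ε (σ p) ≗σ future (induced (orientation e)) p
    future≗ = side-≗σ {ε} isPlus (λ p w w≢p → e≡induced p w (w≢p ∘ sym))
    past≗ : ∀ p → past ε (σ p) ≗σ past (induced (orientation e)) p
    past≗ = side-≗σ {ε} (isPlus ∘ opposite) (λ p w w≢p → e≡induced p w (w≢p ∘ sym))

-- The sign identity

-- The hypotheses on R and ε are arguments of the lemmas rather than module parameters: with the
-- composition hypothesis in scope, checking the with-abstractions below is prohibitively expensive.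
module SignIdentity {c ℓ : Level} (R : CommutativeRing c ℓ)
                    {L : Fin 7 → Subset 7} (fp : IsFanoPlane L) (ε : Fin 7 → Fin 7 → Sign) where
  open CommutativeRing R hiding (zero) renaming (refl to ≈-refl; sym to ≈-sym; trans to ≈-trans)
  open Octonions R fp ε
  open FanoCube fp using (third)
  open FanoGeometry fp using (_∔_; ∔-just; ∔-injectiveʳ; ∔-exchange; third≢ˡ; third≢ʳ; third-involutive)
  open import Algebra.Properties.Ring ring using (-1*x≈-x; -‿involutive; -‿+-comm; -0#≈0#; +-cancelˡ)
  open import Algebra.Properties.CommutativeSemigroup +-commutativeSemigroup using (interchange)
  open import Algebra.Properties.Semiring.Sum semiring
    using (sum; sum-cong-≋; ∑-distrib-+; *-distribˡ-sum; sum-replicate-zero)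
  open import Algebra.Solver.Ring.NaturalCoefficients.Default commutativeSemiring
  open import Relation.Binary.Reasoning.Setoid setoid

  κ : V → V → Sign
  κ nothing _ = plus
  κ (just P) nothing = plus
  κ (just P) (just Q) with P ≟ Q
  ... | yes _ = minus
  ... | no _ = ε P Q

  κ-points : ∀ {P Q} → P ≢ Q → κ (just P) (just Q) ≡ ε P Q
  κ-points {P} {Q} P≢Q with P ≟ Q
  ... | yes P≡Q = contradiction P≡Q P≢Q
  ... | no _ = refl

  coeff≡κ : ∀ u v → coeff u v ≡ signVal (κ u v)
  coeff≡κ nothing v = refl
  coeff≡κ (just P) nothing = refl
  coeff≡κ (just P) (just Q) with P ≟ Q
  ... | yes _ = refl
  ... | no _ = refl

  index≡∔ : ∀ u v → index u v ≡ u ∔ v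
  index≡∔ nothing v = refl
  index≡∔ (just P) nothing = refl
  index≡∔ (just P) (just Q) with P ≟ Q
  ... | yes _ = refl
  ... | no _ = refl

  sumV-cong : ∀ {f g : V → Carrier} → (∀ v → f v ≈ g v) → sumV f ≈ sumV g
  sumV-cong f≈g = +-cong (f≈g nothing) (sum-cong-≋ (f≈g ∘ just))

  sumV-+ : ∀ (f g : V → Carrier) → sumV (λ v → f v + g v) ≈ sumV f + sumV g
  sumV-+ f g = ≈-trans (+-congˡ (∑-distrib-+ (f ∘ just) (g ∘ just))) (interchange _ _ _ _)

  sumV-*ˡ : ∀ k (f : V → Carrier) → sumV (λ v → k * f v) ≈ k * sumV f
  sumV-*ˡ k f = ≈-trans (+-congˡ (≈-sym (*-distribˡ-sum k (f ∘ just)))) (≈-sym (distribˡ k _ _))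

  sum-sift : ∀ {n} (p : Fin n) (f : Fin n → Carrier) →
             sum (λ q → (if does (p ≟ q) then 1# else 0#) * f q) ≈ f p
  sum-sift {ℕ.suc n} zero f = begin
    1# * f zero + sum (λ q → 0# * f (suc q))
      ≈⟨ +-cong (*-identityˡ (f zero)) (sum-cong-≋ (zeroˡ ∘ f ∘ suc)) ⟩
    f zero + sum {n} (λ _ → 0#)  ≈⟨ +-congˡ (sum-replicate-zero n) ⟩
    f zero + 0#                  ≈⟨ +-identityʳ (f zero) ⟩
    f zero                       ∎
  sum-sift {ℕ.suc n} (suc p) f =
    ≈-trans (+-cong (zeroˡ (f zero)) (sum-sift p (f ∘ suc))) (+-identityˡ (f (suc p)))

  sumV-sift : ∀ u (f : V → Carrier) → sumV (λ w → indicator u w * f w) ≈ f u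
  sumV-sift nothing f = begin
    1# * f nothing + sumFin (λ q → 0# * f (just q))
      ≈⟨ +-cong (*-identityˡ (f nothing)) (sum-cong-≋ (zeroˡ ∘ f ∘ just)) ⟩
    f nothing + sum {7} (λ _ → 0#)  ≈⟨ +-congˡ (sum-replicate-zero 7) ⟩
    f nothing + 0#                  ≈⟨ +-identityʳ (f nothing) ⟩
    f nothing                       ∎
  sumV-sift (just p) f = ≈-trans (+-cong (zeroˡ (f nothing)) (sum-sift p (f ∘ just))) (+-identityˡ (f (just p)))

  indicator-self : ∀ u → indicator u u ≈ 1#
  indicator-self u = reflexive (cong (λ b → if b then 1# else 0#) (dec-true (u ≟V u) refl))

  indicator-distinct : ∀ {u w} → u ≢ w → indicator u w ≈ 0#
  indicator-distinct {u} {w} u≢w = reflexive (cong (λ b → if b then 1# else 0#) (dec-false (u ≟V w) u≢w))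

  pair : V → V → O
  pair a b w = indicator a w + indicator b w

  sum-pair : ∀ a b (f : V → Carrier) → sumV (λ w → pair a b w * f w) ≈ f a + f b
  sum-pair a b f = begin
    sumV (λ w → pair a b w * f w)
      ≈⟨ sumV-cong (λ w → distribʳ (f w) (indicator a w) (indicator b w)) ⟩
    sumV (λ w → indicator a w * f w + indicator b w * f w)
      ≈⟨ sumV-+ (λ w → indicator a w * f w) (λ w → indicator b w * f w) ⟩
    sumV (λ w → indicator a w * f w) + sumV (λ w → indicator b w * f w)
      ≈⟨ +-cong (sumV-sift a f) (sumV-sift b f) ⟩
    f a + f b ∎

  N-pair : ∀ {a b} → a ≢ b → N (pair a b) ≈ 1# + 1#
  N-pair {a} {b} a≢b = begin
    N (pair a b)                                          ≈⟨ sum-pair a b (pair a b) ⟩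
    (indicator a a + indicator b a) + (indicator a b + indicator b b)
      ≈⟨ +-cong (+-cong (indicator-self a) (indicator-distinct (a≢b ∘ sym)))
                (+-cong (indicator-distinct a≢b) (indicator-self b)) ⟩
    (1# + 0#) + (0# + 1#)                                 ≈⟨ +-cong (+-identityʳ 1#) (+-identityˡ 1#) ⟩
    1# + 1#                                               ∎

  term : V → V → V → Carrier
  term u v w = coeff u v * indicator (index u v) w

  product-pair : ∀ a b c d w →
                 (pair a b ·ε pair c d) w ≈ (term a c w + term a d w) + (term b c w + term b d w)
  product-pair a b c d w = begin
    sumV (λ u → sumV λ v → (pair a b u * pair c d v) * term u v w)
      ≈⟨ sumV-cong (λ u → ≈-trans (sumV-cong (λ v → *-assoc (pair a b u) (pair c d v) (term u v w)))
                                 (sumV-*ˡ (pair a b u) (λ v → pair c d v * term u v w))) ⟩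
    sumV (λ u → pair a b u * sumV (λ v → pair c d v * term u v w))
      ≈⟨ sumV-cong (λ u → *-congˡ {pair a b u} (sum-pair c d (λ v → term u v w))) ⟩
    sumV (λ u → pair a b u * (term u c w + term u d w))
      ≈⟨ sum-pair a b (λ u → term u c w + term u d w) ⟩
    (term a c w + term a d w) + (term b c w + term b d w) ∎

  N-combination : ∀ A B {p q} → p ≢ q → N (λ w → A * indicator p w + B * indicator q w) ≈ A * A + B * B
  N-combination A B {p} {q} p≢q = begin
    sumV (λ w → Y w * Y w)
      ≈⟨ sumV-cong (λ w → expand A B (indicator p w) (indicator q w) (Y w)) ⟩
    sumV (λ w → A * (indicator p w * Y w) + B * (indicator q w * Y w))
      ≈⟨ sumV-+ (λ w → A * (indicator p w * Y w)) (λ w → B * (indicator q w * Y w)) ⟩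
    sumV (λ w → A * (indicator p w * Y w)) + sumV (λ w → B * (indicator q w * Y w))
      ≈⟨ +-cong (sumV-*ˡ A (λ w → indicator p w * Y w)) (sumV-*ˡ B (λ w → indicator q w * Y w)) ⟩
    A * sumV (λ w → indicator p w * Y w) + B * sumV (λ w → indicator q w * Y w)
      ≈⟨ +-cong (*-congˡ (sumV-sift p Y)) (*-congˡ (sumV-sift q Y)) ⟩
    A * Y p + B * Y q                                          ≈⟨ +-cong (*-congˡ Yp≈A) (*-congˡ Yq≈B) ⟩
    A * A + B * B                                              ∎
    where
    Y : V → Carrier
    Y w = A * indicator p w + B * indicator q w
    expand : ∀ A B x y z → (A * x + B * y) * z ≈ A * (x * z) + B * (y * z)
    expand = solve 5 (λ A B x y z → (A :* x :+ B :* y) :* z := A :* (x :* z) :+ B :* (y :* z)) ≈-refl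
    Yp≈A : Y p ≈ A
    Yp≈A = ≈-trans (+-cong (≈-trans (*-congˡ (indicator-self p)) (*-identityʳ A))
                         (≈-trans (*-congˡ (indicator-distinct (p≢q ∘ sym))) (zeroʳ B))) (+-identityʳ A)
    Yq≈B : Y q ≈ B
    Yq≈B = ≈-trans (+-cong (≈-trans (*-congˡ (indicator-distinct p≢q)) (zeroʳ A))
                         (≈-trans (*-congˡ (indicator-self q)) (*-identityʳ B))) (+-identityˡ B)

  two : Carrier
  two = 1# + 1#

  signVal-* : ∀ s t → signVal s * signVal t ≈ signVal (s Sign.* t)
  signVal-* plus t = *-identityˡ (signVal t)
  signVal-* minus plus = *-identityʳ (- 1#)
  signVal-* minus minus = ≈-trans (-1*x≈-x (- 1#)) (-‿involutive 1#)

  square-of-sum : ∀ s t → (signVal s + signVal t) * (signVal s + signVal t) ≈ two + two * signVal (s Sign.* t)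
  square-of-sum s t = begin
    (signVal s + signVal t) * (signVal s + signVal t)
      ≈⟨ expand (signVal s) (signVal t) ⟩
    (signVal s * signVal s + signVal t * signVal t) + two * (signVal s * signVal t)
      ≈⟨ +-cong (+-cong (square s) (square t)) (*-congˡ (signVal-* s t)) ⟩
    two + two * signVal (s Sign.* t) ∎
    where
    expand : ∀ x y → (x + y) * (x + y) ≈ (x * x + y * y) + two * (x * y)
    expand = solve 2 (λ x y → (x :+ y) :* (x :+ y) := (x :* x :+ y :* y) :+ (con 1 :+ con 1) :* (x :* y)) ≈-refl
    square : ∀ s → signVal s * signVal s ≈ 1#
    square s = ≈-trans (signVal-* s s) (reflexive (cong signVal (Sign.s*s≡+ s)))

  signVal-sum≈0 : CharNot2 R → ∀ s t → signVal s + signVal t ≈ 0# → s ≡ opposite t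
  signVal-sum≈0 char≢2 plus plus 2≈0 = contradiction 2≈0 char≢2
  signVal-sum≈0 char≢2 plus minus _ = refl
  signVal-sum≈0 char≢2 minus plus _ = refl
  signVal-sum≈0 char≢2 minus minus -2≈0 = contradiction (begin
    1# + 1#              ≈⟨ +-cong (-‿involutive 1#) (-‿involutive 1#) ⟨
    - - 1# + - - 1#      ≈⟨ -‿+-comm (- 1#) (- 1#) ⟩
    - (- 1# + - 1#)      ≈⟨ -‿cong -2≈0 ⟩
    - 0#                 ≈⟨ -0#≈0# ⟩
    0#                   ∎) char≢2

  halve : IsField R → CharNot2 R → ∀ x → two * x ≈ 0# → x ≈ 0#
  halve (_ , inverse) char≢2 x 2x≈0 with h , 2h≈1 ← inverse two char≢2 = begin
    x                ≈⟨ *-identityˡ x ⟨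
    1# * x           ≈⟨ *-congʳ 2h≈1 ⟨
    (two * h) * x    ≈⟨ *-congʳ (*-comm two h) ⟩
    (h * two) * x    ≈⟨ *-assoc h two x ⟩
    h * (two * x)    ≈⟨ *-congˡ 2x≈0 ⟩
    h * 0#           ≈⟨ zeroʳ h ⟩
    0#               ∎

  opposite-products : IsField R → CharNot2 R → ∀ s₁ s₂ s₃ s₄ →
    (signVal s₁ + signVal s₂) * (signVal s₁ + signVal s₂) + (signVal s₃ + signVal s₄) * (signVal s₃ + signVal s₄)
      ≈ two * two →
    s₁ Sign.* s₂ ≡ opposite (s₃ Sign.* s₄)
  opposite-products isField char≢2 s₁ s₂ s₃ s₄ sum≈4 =
    signVal-sum≈0 char≢2 (s₁ Sign.* s₂) (s₃ Sign.* s₄) (halve isField char≢2 (π₁₂ + π₃₄) 2[π₁₂+π₃₄]≈0)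
    where
    π₁₂ π₃₄ : Carrier
    π₁₂ = signVal (s₁ Sign.* s₂)
    π₃₄ = signVal (s₃ Sign.* s₄)
    regroup : ∀ a b → (two + two * a) + (two + two * b) ≈ two * two + two * (a + b)
    regroup = solve 2 (λ a b → (c₂ :+ c₂ :* a) :+ (c₂ :+ c₂ :* b) := c₂ :* c₂ :+ c₂ :* (a :+ b)) ≈-refl
      where
      c₂ : Polynomial 2
      c₂ = con 1 :+ con 1
    2[π₁₂+π₃₄]≈0 : two * (π₁₂ + π₃₄) ≈ 0#
    2[π₁₂+π₃₄]≈0 = +-cancelˡ (two * two) _ _ (begin
      two * two + two * (π₁₂ + π₃₄)          ≈⟨ regroup π₁₂ π₃₄ ⟨
      (two + two * π₁₂) + (two + two * π₃₄)  ≈⟨ +-cong (square-of-sum s₁ s₂) (square-of-sum s₃ s₄) ⟨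
      _                                      ≈⟨ sum≈4 ⟩
      two * two                              ≈⟨ +-identityʳ (two * two) ⟨
      two * two + 0#                         ∎)

  sign-identity : IsField R → CharNot2 R → IsComposition →
                  ∀ {a b c d} → a ≢ b → c ≢ d → a ∔ c ≡ b ∔ d →
                  κ a c Sign.* κ b d ≡ opposite (κ a d Sign.* κ b c)
  sign-identity isField char≢2 composition {a} {b} {c} {d} a≢b c≢d a∔c≡b∔d =
    opposite-products isField char≢2 (κ a c) (κ b d) (κ a d) (κ b c) (begin
      _                                    ≡⟨ cong₂ (λ A B → A * A + B * B) (cong₂ _+_ (coeff≡κ a c) (coeff≡κ b d))
                                                                             (cong₂ _+_ (coeff≡κ a d) (coeff≡κ b c)) ⟨
      A * A + B * B                        ≈⟨ N-combination A B ac≢ad ⟨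
      N (λ w → A * indicator ac w + B * indicator ad w) ≈⟨ sumV-cong (λ w → *-cong (product≈ w) (product≈ w)) ⟨
      N (pair a b ·ε pair c d)             ≈⟨ composition (pair a b) (pair c d) ⟩
      N (pair a b) * N (pair c d)          ≈⟨ *-cong (N-pair a≢b) (N-pair c≢d) ⟩
      two * two                            ∎)
    where
    ac ad : V
    ac = a ∔ c
    ad = a ∔ d
    A B : Carrier
    A = coeff a c + coeff b d
    B = coeff a d + coeff b c
    ac≢ad : ac ≢ ad
    ac≢ad = c≢d ∘ ∔-injectiveʳ a
    at : ∀ u v {i} w → index u v ≡ i → term u v w ≡ coeff u v * indicator i w
    at u v w index≡i = cong (λ i → coeff u v * indicator i w) index≡i
    collect : ∀ x₁ x₂ x₃ x₄ u v → (x₁ * u + x₂ * v) + (x₃ * v + x₄ * u) ≈ (x₁ + x₄) * u + (x₂ + x₃) * v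
    collect = solve 6 (λ x₁ x₂ x₃ x₄ u v → (x₁ :* u :+ x₂ :* v) :+ (x₃ :* v :+ x₄ :* u)
                                          := (x₁ :+ x₄) :* u :+ (x₂ :+ x₃) :* v) ≈-refl
    product≈ : ∀ w → (pair a b ·ε pair c d) w ≈ A * indicator ac w + B * indicator ad w
    product≈ w = begin
      (pair a b ·ε pair c d) w                                  ≈⟨ product-pair a b c d w ⟩
      (term a c w + term a d w) + (term b c w + term b d w)
        ≡⟨ cong₂ _+_ (cong₂ _+_ (at a c w (index≡∔ a c)) (at a d w (index≡∔ a d)))
                       (cong₂ _+_ (at b c w (trans (index≡∔ b c) (sym (∔-exchange a b c d a∔c≡b∔d))))
                                    (at b d w (trans (index≡∔ b d) (sym a∔c≡b∔d)))) ⟩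
      (coeff a c * indicator ac w + coeff a d * indicator ad w) +
      (coeff b c * indicator ad w + coeff b d * indicator ac w)
        ≈⟨ collect (coeff a c) (coeff a d) (coeff b c) (coeff b d) (indicator ac w) (indicator ad w) ⟩
      A * indicator ac w + B * indicator ad w                     ∎

  turn-identity : IsField R → CharNot2 R → IsComposition → TurnIdentity third ε
  turn-identity isField char≢2 composition P Q P≢Q =
    trans (sym (κ-points P≢PQ)) (trans identity (cong opposite (κ-points P≢Q)))
    where
    P≢PQ : P ≢ third P Q
    P≢PQ = third≢ˡ P≢Q ∘ sym
    identity : κ (just P) (just (third P Q)) ≡ opposite (κ (just P) (just Q))
    identity = sign-identity isField char≢2 composition {nothing} {just P} {just Q} {just (third P Q)}
      (λ ()) (third≢ʳ P≢Q ∘ sym ∘ Maybe.just-injective)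
      (sym (trans (∔-just P≢PQ) (cong just (third-involutive P≢Q))))

  quadrangle-identity : IsField R → CharNot2 R → IsComposition → ∀ P → QuadrangleIdentityAt third P ε
  quadrangle-identity isField char≢2 composition P Q S U P≢Q P≢S P≢U Q≢S Q≢U S≢U PQ≡SU =
    trans (cong₂ Sign._*_ (sym (κ-points P≢Q)) (sym (κ-points S≢U)))
      (trans (sign-identity isField char≢2 composition (P≢S ∘ Maybe.just-injective) (Q≢U ∘ Maybe.just-injective)
                 (trans (∔-just P≢Q) (trans (cong just PQ≡SU) (sym (∔-just S≢U)))))
               (cong opposite (cong₂ Sign._*_ (κ-points P≢U) (κ-points (Q≢S ∘ sym)))))


theorem2p7 : ∀ {c ℓ : Level} (R : CommutativeRing c ℓ) → IsField R → CharNot2 R →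
    ∀ {L : Fin 7 → Subset 7} (fp : IsFanoPlane L) (ε : Fin 7 → Fin 7 → Sign) →
    IsMultiplicationFactor ε →
    Octonions.IsComposition R fp ε →
    ((∀ P → IsLine L (future ε P))
       × (∀ P → IsTriangle L (past ε P)) × IsFanoPlane (past ε))
    ⊎ ((∀ P → IsLine L (past ε P))
       × (∀ P → IsTriangle L (future ε P)) × IsFanoPlane (future ε))
theorem2p7 R isField char≢2 fp ε antisymmetric composition =
  dichotomy antisymmetric (turn-identity isField char≢2 composition) (quadrangle-identity isField char≢2 composition)
  where
  open FanoGeometry fp using (dichotomy)
  open SignIdentity R fp ε
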